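{- Let $S$ be a metric-locating-dominating set of a graph $G$, and let $u\in S$ and $x\in V(G)\setminus S$ be such that the pair $\{u,x\}$ is not doubly resolved by $S$. Then $N(x)\cap S=\{u\}$. Furthermore, $x$ is the only vertex $x'$ of $V(G)\setminus S$ such that $\{u,x'\}$ is not doubly resolved by $S$.
   Context: All graphs are finite, simple, undirected and connected, with at least $2$ vertices; $d(u,v)$ is the length of a shortest $u$-$v$ path and $N(x)$ is the set of neighbors of $x$. A set $S\subseteq V(G)$ is a resolving set if for every two distinct vertices $x,y$ there is $u\in S$ with $d(u,x)\neq d(u,y)$; it is a dominating set if every vertex not in $S$ has a neighbor in $S$; it is a metric-locating-dominating set if it is both resolving and dominating. Two vertices $u,v$ doubly resolve a pair $\{x,y\}$ if $d(u,x)-d(u,y)\neq d(v,x)-d(v,y)$; a set $S$ doubly resolves $\{x,y\}$ if some two vertices of $S$ doubly resolve $\{x,y\}$. -}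

module Defs where

open import Data.Nat using (ℕ; zero; suc)
open import Data.Fin using (Fin; _≟_)
open import Data.Bool using (Bool; true; false; _∧_; if_then_else_)
open import Data.Integer using (ℤ; +_; _-_)
open import Data.Product using (Σ; _×_; ∃-syntax)
open import Data.Empty using (⊥)
open import Relation.Nullary using (¬_; Dec; does)
open import Relation.Binary.PropositionalEquality using (_≡_; _≢_)
open import Data.Vec.Functional using (foldr)

record Graph (n : ℕ) : Set₁ where
  field
    Adj    : Fin n → Fin n → Set
    adj?   : ∀ u v → Dec (Adj u v)
    irrefl : ∀ u → ¬ Adj u u
    sym    : ∀ {u v} → Adj u v → Adj v u

open Graph public

data Walk {n : ℕ} (G : Graph n) : Fin n → Fin n → ℕ → Set where
  here : ∀ {u} → Walk G u u zero
  step : ∀ {u w v k} → Adj G u w → Walk G w v k → Walk G u v (suc k)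

Connected : ∀ {n} → Graph n → Set
Connected G = ∀ u v → ∃[ k ] Walk G u v k

IsDist : ∀ {n} → Graph n → Fin n → Fin n → ℕ → Set
IsDist G u v k = Walk G u v k × (∀ j → Walk G u v j → k Data.Nat.≤ j)

Subset : ℕ → Set₁
Subset n = Fin n → Set

Resolving : ∀ {n} → Graph n → Subset n → Set
Resolving {n} G S = ∀ (x y : Fin n) → x ≢ y →
  Σ (Fin n) λ u → S u × (∀ a b → IsDist G u x a → IsDist G u y b → a ≢ b)

Dominating : ∀ {n} → Graph n → Subset n → Set
Dominating {n} G S = ∀ (x : Fin n) → ¬ S x → Σ (Fin n) λ w → S w × Adj G x w

MetricLocatingDominating : ∀ {n} → Graph n → Subset n → Set
MetricLocatingDominating G S = Resolving G S × Dominating G S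

DoublyResolvesBy : ∀ {n} → Graph n → Fin n → Fin n → Fin n → Fin n → Set
DoublyResolvesBy G u v x y = ∀ a b c e →
  IsDist G u x a → IsDist G u y b → IsDist G v x c → IsDist G v y e →
  (+ a - + b) ≢ (+ c - + e)

DoublyResolves : ∀ {n} → Graph n → Subset n → Fin n → Fin n → Set
DoublyResolves {n} G S x y =
  Σ (Fin n) λ u → Σ (Fin n) λ v → S u × S v × DoublyResolvesBy G u v x y

-- If w ∈ S were a neighbour of x other than u, then d(u,u) − d(u,x) < 0 ≤ d(w,u) − d(w,x),
-- so u and w would doubly resolve {u,x}; domination then forces N(x) ∩ S = {u}.
-- Consequently, for every s ∈ S the pair (u,s) failing to doubly resolve {u,x} means
-- d(s,x) = d(s,u) + 1. A second such x' would satisfy the same identity, so no vertex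
-- of S could tell x and x' apart, contradicting that S is resolving.
module Submission where

open import Defs
open import Data.Nat using (ℕ; _≤_; zero; suc; z≤n; s≤s)
open import Data.Nat.Properties using (≤-antisym) renaming (_≟_ to _≟ℕ_)
open import Data.Fin using (Fin; _≟_)
open import Data.Integer using (+_; -[1+_]; _-_; _⊖_)
open import Data.Integer.Properties using ([1+m]⊖[1+n]≡m⊖n; m-n≡m⊖n)
open import Data.Product using (∃; ∃-syntax; _×_; _,_; proj₂)
open import Data.Empty using (⊥-elim)
open import Function using (_$_)
open import Relation.Nullary using (¬_; yes; no)
open import Relation.Binary.PropositionalEquality
  using (_≡_; _≢_; refl; trans; cong; subst)
  renaming (sym to ≡-sym)

module _ {n : ℕ} (G : Graph n) where

  walk-zero⇒≡ : ∀ {u v} → Walk G u v 0 → u ≡ v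
  walk-zero⇒≡ here = refl

  isDist-unique : ∀ {u v a b} → IsDist G u v a → IsDist G u v b → a ≡ b
  isDist-unique (wa , minA) (wb , minB) = ≤-antisym (minA _ wb) (minB _ wa)

  isDist-self : ∀ {u a} → IsDist G u u a → a ≡ 0
  isDist-self (_ , minimal) with minimal 0 here
  ... | z≤n = refl

  isDist-distinct : ∀ {u v a} → u ≢ v → IsDist G u v a → ∃[ a′ ] a ≡ suc a′
  isDist-distinct {a = zero}  u≢v (w , _) = ⊥-elim (u≢v (walk-zero⇒≡ w))
  isDist-distinct {a = suc a} _   _       = a , refl

  isDist-adjacent : ∀ {u v a} → Adj G u v → IsDist G u v a → a ≡ 1
  isDist-adjacent {u} u~v d
    with isDist-distinct (λ { refl → irrefl G u u~v }) d
  ... | _ , refl with proj₂ d 1 (step u~v here)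
  ... | s≤s z≤n = refl

  -- DoublyResolvesBy quantifies over the distances, so it holds vacuously when they
  -- do not exist; failing to hold therefore exhibits them (up to double negation).
  ¬doublyResolvesBy⇒distances : ∀ {u v x y} → ¬ DoublyResolvesBy G u v x y →
    ¬ ¬ (∃ (IsDist G v x) × ∃ (IsDist G v y))
  ¬doublyResolvesBy⇒distances ¬dr k =
    ¬dr λ _ _ c e _ _ dc de _ → k ((c , dc) , (e , de))

0-[1+b]≢[1+c]-1 : ∀ b c → + 0 - + suc b ≢ + suc c - + 1
0-[1+b]≢[1+c]-1 b c ()

m⊖n≡-1⇒n≡1+m : ∀ m n → m ⊖ n ≡ -[1+ 0 ] → n ≡ suc m
m⊖n≡-1⇒n≡1+m zero    (suc zero)    refl = refl
m⊖n≡-1⇒n≡1+m zero    (suc (suc n)) ()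
m⊖n≡-1⇒n≡1+m (suc m) zero          ()
m⊖n≡-1⇒n≡1+m (suc m) (suc n) eq
  rewrite [1+m]⊖[1+n]≡m⊖n m n = cong suc (m⊖n≡-1⇒n≡1+m m n eq)

module _ {n : ℕ} (G : Graph n) (S : Subset n) where

  ¬doublyResolves⇒¬by : ∀ {v w x y} → S v → S w →
    ¬ DoublyResolves G S x y → ¬ DoublyResolvesBy G v w x y
  ¬doublyResolves⇒¬by sv sw ¬dr dr = ¬dr (_ , _ , sv , sw , dr)

  module _ {u x : Fin n} (su : S u) (¬sx : ¬ S x) (¬dr : ¬ DoublyResolves G S u x) where

    u≢x : u ≢ x
    u≢x refl = ¬sx su

    neighbourInS⇒≡ : ∀ {w} → Adj G x w → S w → w ≡ u
    neighbourInS⇒≡ {w} x~w sw with w ≟ u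
    ... | yes w≡u = w≡u
    ... | no  w≢u = ⊥-elim (¬doublyResolves⇒¬by su sw ¬dr doubly)
      where
      doubly : DoublyResolvesBy G u w u x
      doubly _ _ _ _ da db dc de
        with isDist-self G da | isDist-distinct G u≢x db
           | isDist-distinct G w≢u dc | isDist-adjacent G (sym G x~w) de
      ... | refl | b , refl | c , refl | refl = 0-[1+b]≢[1+c]-1 b c

    adjacent : Dominating G S → Adj G x u
    adjacent dom with dom x ¬sx
    ... | w , sw , x~w = subst (Adj G x) (neighbourInS⇒≡ x~w sw) x~w

    dist-via-u : Adj G x u → ∀ {s c e} → S s →
      IsDist G s u c → IsDist G s x e → e ≡ suc c
    dist-via-u x~u {s} {c} {e} ss dsu dsx with e ≟ℕ suc c
    ... | yes e≡1+c = e≡1+c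
    ... | no  e≢1+c = ⊥-elim (¬doublyResolves⇒¬by su ss ¬dr doubly)
      where
      doubly : DoublyResolvesBy G u s u x
      doubly _ _ _ _ da db dc de eq
        with isDist-self G da | isDist-adjacent G (sym G x~u) db
           | isDist-unique G dsu dc | isDist-unique G dsx de
      ... | refl | refl | refl | refl =
        e≢1+c (m⊖n≡-1⇒n≡1+m c e (≡-sym (trans eq (m-n≡m⊖n c e))))

lemma2 : ∀ {n : ℕ} → 2 ≤ n → (G : Graph n) → Connected G →
    (S : Subset n) → MetricLocatingDominating G S →
    (u x : Fin n) → S u → ¬ S x → ¬ DoublyResolves G S u x →
    ((∀ w → (Adj G x w × S w) → w ≡ u) × Adj G x u × S u)
    × (∀ x' → ¬ S x' → ¬ DoublyResolves G S u x' → x' ≡ x)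
lemma2 _ G _ S (resolving , dominating) u x su ¬sx ¬dr =
  ((λ _ (x~w , sw) → neighbourInS⇒≡ G S su ¬sx ¬dr x~w sw) , y~u ¬sx ¬dr , su) , unique
  where
  y~u : ∀ {y} → ¬ S y → ¬ DoublyResolves G S u y → Adj G y u
  y~u ¬sy ¬dr-y = adjacent G S su ¬sy ¬dr-y dominating

  unique : ∀ x' → ¬ S x' → ¬ DoublyResolves G S u x' → x' ≡ x
  unique x' ¬sx' ¬dr' with x' ≟ x
  ... | yes x'≡x = x'≡x
  ... | no  x'≢x with resolving x x' (λ x≡x' → x'≢x (≡-sym x≡x'))
  ... | s , ss , separates = ⊥-elim $
    ¬doublyResolvesBy⇒distances G (¬doublyResolves⇒¬by G S su ss ¬dr)
      λ ((c , dsu) , (e , dsx)) →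
    ¬doublyResolvesBy⇒distances G (¬doublyResolves⇒¬by G S su ss ¬dr')
      λ (_ , (e' , dsx')) →
    separates e e' dsx dsx'
      (trans (dist-via-u G S su ¬sx ¬dr (y~u ¬sx ¬dr) ss dsu dsx)
             (≡-sym (dist-via-u G S su ¬sx' ¬dr' (y~u ¬sx' ¬dr') ss dsu dsx')))
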